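{- Let $G$ be a normal hypergraph and $s\ge k\ge1$ integers such that $G$ is $(s,k)$-unbreakable and $|V(G)|\ge 3s$. Then the family $\mathscr{T}=\{A\subseteq E(G): |V(A)|\le|V(\overline A)| \text{ and } \lambda(A)<k\}$ is a tangle of order $k$ of $G$.
   Context: A hypergraph $G$ consists of finite sets $V(G)$, $E(G)$ and for each hyperedge $e$ a set $V(e)\subseteq V(G)$ (distinct hyperedges may share vertex sets), every vertex lying in some $V(e)$; it is normal if every vertex lies in $V(e)$ for at least two distinct hyperedges. For $A\subseteq E(G)$: $V(A)=\bigcup_{e\in A}V(e)$, $\overline A=E(G)\setminus A$, $\lambda(A)=|V(A)\cap V(\overline A)|$. $G$ is $(s,k)$-unbreakable if there is no $A\subseteq E(G)$ with $\lambda(A)<k$, $|V(A)|\ge s$ and $|V(\overline A)|\ge s$. A tangle of order $k$ of $G$ is a family $\mathscr{T}$ of subsets of $E(G)$ such that: (1) $\lambda(A)<k$ for all $A\in\mathscr{T}$; (2) for every $A\subseteq E(G)$ with $\lambda(A)<k$, $A\in\mathscr{T}$ or $\overline A\in\mathscr{T}$; (3) no $A,B,C\in\mathscr{T}$ satisfy $A\cup B\cup C=E(G)$; (4) $E(G)\setminus\{e\}\notin\mathscr{T}$ for every $e\in E(G)$. -}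

module Defs where

open import Data.Nat using (ℕ; _≤_; _<_; _≥_)
open import Data.Bool using (Bool; true; false; _∧_; _∨_)
open import Data.Fin using (Fin)
open import Data.Fin.Subset using (Subset; _∈_; _∉_; ∁; _∩_; _∪_; ∣_∣; ⁅_⁆; ⊤)
open import Data.Vec using (Vec; tabulate; lookup; foldr; replicate)
open import Data.Product using (Σ; ∃; _×_; _,_)
open import Relation.Binary.PropositionalEquality using (_≡_; _≢_)
open import Relation.Nullary using (¬_)
open import Data.Sum using (_⊎_)

-- Distinct
-- hyperedges may share vertex sets.
record Hypergraph : Set where
  field
    n    : ℕ
    m    : ℕ
    Ve   : Fin m → Subset n
    covers : ∀ (v : Fin n) → ∃ λ (e : Fin m) → v ∈ Ve e

open Hypergraph public

VA : (G : Hypergraph) → Subset (m G) → Subset (n G)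
VA G A = tabulate λ v → anyE (tabulate λ e → lookup A e ∧ lookup (Ve G e) v)
  where
  anyE : ∀ {k} → Vec Bool k → Bool
  anyE = foldr _ _∨_ false

lam : (G : Hypergraph) → Subset (m G) → ℕ
lam G A = ∣ VA G A ∩ VA G (∁ A) ∣

Normal : Hypergraph → Set
Normal G = ∀ (v : Fin (n G)) →
  Σ (Fin (m G)) λ e → Σ (Fin (m G)) λ f → e ≢ f × v ∈ Ve G e × v ∈ Ve G f

Unbreakable : Hypergraph → ℕ → ℕ → Set
Unbreakable G s k = ¬ (Σ (Subset (m G)) λ A →
  lam G A < k × s ≤ ∣ VA G A ∣ × s ≤ ∣ VA G (∁ A) ∣)

record IsTangle (G : Hypergraph) (k : ℕ) (T : Subset (m G) → Set) : Set where
  field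
    order  : ∀ A → T A → lam G A < k
    choice : ∀ A → lam G A < k → T A ⊎ T (∁ A)
    noCover : ∀ A B C → T A → T B → T C → ¬ (A ∪ B ∪ C ≡ ⊤)
    noCoEdge : ∀ (e : Fin (m G)) → ¬ T (∁ ⁅ e ⁆)


smallSide : (G : Hypergraph) → ℕ → Subset (m G) → Set
smallSide G k A = ∣ VA G A ∣ ≤ ∣ VA G (∁ A) ∣ × lam G A < k

-- A member of the family has fewer than s vertices on its side, by unbreakability.
-- Three members covering E(G) would therefore cover V(G), which has at least 3s
-- vertices, with fewer than 3s of them; and in a normal hypergraph the complement
-- of a single edge already spans all of V(G), so it cannot be a member either.
module Submission where

open import Defs
open import Data.Nat using (ℕ; suc; _≤_; _<_; _*_; _+_; z≤n; s≤s)
open import Data.Nat.Properties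
  using (≤-trans; +-monoʳ-≤; +-mono-<; +-suc; +-identityʳ; m≤m+n; n≤1+n; <⇒≤; ≰⇒>; <⇒≱; _≤?_)
open import Data.Bool using (Bool; true; false; _∧_; _∨_)
open import Data.Fin using (Fin; zero; suc; _≟_)
open import Data.Fin.Subset using (Subset; Nonempty; _∈_; ∁; _∪_; ∣_∣; ⁅_⁆; ⊤; _⊆_)
open import Data.Fin.Subset.Properties
  using (∈⊤; ∣⊤∣≡n; p⊆q⇒∣p∣≤∣q∣; x∈p∪q⁻; x∈p∪q⁺; x∉p⇒x∈∁p; x∈⁅y⁆⇒x≡y; ∩-comm; ∪-∩-booleanAlgebra)
import Algebra.Lattice.Properties.BooleanAlgebra as BooleanAlgebraProperties
open import Data.Vec using ([]; _∷_; tabulate; lookup; foldr; here; there)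
open import Data.Vec.Properties using ([]=⇒lookup; lookup⇒[]=; lookup∘tabulate)
open import Data.Product using (∃; _×_; _,_)
open import Data.Sum using (_⊎_; inj₁; inj₂)
open import Relation.Binary.PropositionalEquality using (_≡_; refl; sym; trans; cong; subst)
open import Relation.Nullary using (¬_; yes; no)
open import Data.Empty using (⊥-elim)

∁-involutive : ∀ {k} (p : Subset k) → ∁ (∁ p) ≡ p
∁-involutive {k} = BooleanAlgebraProperties.¬-involutive (∪-∩-booleanAlgebra k)

∣p∪q∣≤∣p∣+∣q∣ : ∀ {k} (p q : Subset k) → ∣ p ∪ q ∣ ≤ ∣ p ∣ + ∣ q ∣
∣p∪q∣≤∣p∣+∣q∣ []          []          = z≤n
∣p∪q∣≤∣p∣+∣q∣ (true ∷ p)  (false ∷ q) = s≤s (∣p∪q∣≤∣p∣+∣q∣ p q)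
∣p∪q∣≤∣p∣+∣q∣ (true ∷ p)  (true ∷ q)  = s≤s (≤-trans (∣p∪q∣≤∣p∣+∣q∣ p q) (+-monoʳ-≤ ∣ p ∣ (n≤1+n ∣ q ∣)))
∣p∪q∣≤∣p∣+∣q∣ (false ∷ p) (true ∷ q)  = subst (suc ∣ p ∪ q ∣ ≤_) (sym (+-suc ∣ p ∣ ∣ q ∣)) (s≤s (∣p∪q∣≤∣p∣+∣q∣ p q))
∣p∪q∣≤∣p∣+∣q∣ (false ∷ p) (false ∷ q) = ∣p∪q∣≤∣p∣+∣q∣ p q

⊤⊆p⇒n≤∣p∣ : ∀ {k} {p : Subset k} → ⊤ ⊆ p → k ≤ ∣ p ∣
⊤⊆p⇒n≤∣p∣ {k} {p} ⊤⊆p = subst (_≤ ∣ p ∣) (∣⊤∣≡n k) (p⊆q⇒∣p∣≤∣q∣ ⊤⊆p)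

∈-tabulate⁻ : ∀ {k} (f : Fin k → Bool) {i} → i ∈ tabulate f → f i ≡ true
∈-tabulate⁻ f {i} i∈ = trans (sym (lookup∘tabulate f i)) ([]=⇒lookup i∈)

∈-tabulate⁺ : ∀ {k} (f : Fin k → Bool) {i} → f i ≡ true → i ∈ tabulate f
∈-tabulate⁺ f {i} fi = lookup⇒[]= i (tabulate f) (trans (lookup∘tabulate f i) fi)

∨-fold⇒Nonempty : ∀ {k} (p : Subset k) → foldr _ _∨_ false p ≡ true → Nonempty p
∨-fold⇒Nonempty (true ∷ p)  _ = zero , here
∨-fold⇒Nonempty (false ∷ p) h with ∨-fold⇒Nonempty p h
... | i , i∈p = suc i , there i∈p

∈⇒∨-fold : ∀ {k} {p : Subset k} {i} → i ∈ p → foldr _ _∨_ false p ≡ true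
∈⇒∨-fold here                    = refl
∈⇒∨-fold {p = true ∷ _}  (there _) = refl
∈⇒∨-fold {p = false ∷ _} (there i∈p) = ∈⇒∨-fold i∈p

module _ (G : Hypergraph) where

  -- v ∈ VA G A unfolds to the nonemptiness of this subset.
  incident : Subset (m G) → Fin (n G) → Subset (m G)
  incident A v = tabulate λ e → lookup A e ∧ lookup (Ve G e) v

  ∈-incident⁻ : ∀ {A v e} → e ∈ incident A v → e ∈ A × v ∈ Ve G e
  ∈-incident⁻ {A} {v} {e} e∈ with lookup A e in eA | lookup (Ve G e) v in ev | ∈-tabulate⁻ _ e∈
  ... | true | true | _ = lookup⇒[]= e A eA , lookup⇒[]= v (Ve G e) ev

  ∈-incident⁺ : ∀ {A v e} → e ∈ A → v ∈ Ve G e → e ∈ incident A v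
  ∈-incident⁺ {A} {v} {e} e∈A v∈e = ∈-tabulate⁺ (λ e → lookup A e ∧ lookup (Ve G e) v) e∧v
    where
    e∧v : lookup A e ∧ lookup (Ve G e) v ≡ true
    e∧v rewrite []=⇒lookup e∈A | []=⇒lookup v∈e = refl

  x∈VA⁻ : ∀ {A v} → v ∈ VA G A → ∃ λ e → e ∈ A × v ∈ Ve G e
  x∈VA⁻ {A} {v} v∈ with ∨-fold⇒Nonempty (incident A v) (∈-tabulate⁻ _ v∈)
  ... | e , e∈ = e , ∈-incident⁻ e∈

  x∈VA⁺ : ∀ {A v e} → e ∈ A → v ∈ Ve G e → v ∈ VA G A
  x∈VA⁺ {A} e∈A v∈e = ∈-tabulate⁺ (λ v → foldr (λ _ → Bool) _∨_ false (incident A v))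
    (∈⇒∨-fold (∈-incident⁺ e∈A v∈e))

  ⊤⊆VA⊤ : ⊤ ⊆ VA G ⊤
  ⊤⊆VA⊤ {v} _ with covers G v
  ... | e , v∈e = x∈VA⁺ ∈⊤ v∈e

  VA-∪ : ∀ A B → VA G (A ∪ B) ⊆ VA G A ∪ VA G B
  VA-∪ A B v∈ with x∈VA⁻ v∈
  ... | e , e∈A∪B , v∈e with x∈p∪q⁻ A B e∈A∪B
  ... | inj₁ e∈A = x∈p∪q⁺ (inj₁ (x∈VA⁺ e∈A v∈e))
  ... | inj₂ e∈B = x∈p∪q⁺ (inj₂ (x∈VA⁺ e∈B v∈e))

  ⊤⊆VA∁⁅e⁆ : Normal G → ∀ e → ⊤ ⊆ VA G (∁ ⁅ e ⁆)
  ⊤⊆VA∁⁅e⁆ normal e {v} _ with normal v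
  ... | e₁ , e₂ , e₁≢e₂ , v∈e₁ , v∈e₂ with e₁ ≟ e
  ... | yes refl = x∈VA⁺ (x∉p⇒x∈∁p λ e₂∈⁅e₁⁆ → e₁≢e₂ (sym (x∈⁅y⁆⇒x≡y _ e₂∈⁅e₁⁆))) v∈e₂
  ... | no e₁≢e = x∈VA⁺ (x∉p⇒x∈∁p λ e₁∈⁅e⁆ → e₁≢e (x∈⁅y⁆⇒x≡y _ e₁∈⁅e⁆)) v∈e₁

  lam-∁ : ∀ A → lam G (∁ A) ≡ lam G A
  lam-∁ A rewrite ∁-involutive A = cong ∣_∣ (∩-comm (VA G (∁ A)) (VA G A))

  covering-bound : ∀ A B C → A ∪ B ∪ C ≡ ⊤ →
    n G ≤ ∣ VA G A ∣ + (∣ VA G B ∣ + ∣ VA G C ∣)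
  covering-bound A B C cover = ≤-trans (⊤⊆p⇒n≤∣p∣ ⊤⊆⋃VA) (≤-trans
    (∣p∪q∣≤∣p∣+∣q∣ (VA G A) (VA G B ∪ VA G C))
    (+-monoʳ-≤ ∣ VA G A ∣ (∣p∪q∣≤∣p∣+∣q∣ (VA G B) (VA G C))))
    where
    ⊤⊆⋃VA : ⊤ ⊆ VA G A ∪ (VA G B ∪ VA G C)
    ⊤⊆⋃VA v∈⊤ with x∈p∪q⁻ (VA G A) _ (VA-∪ A (B ∪ C) (subst (λ X → _ ∈ VA G X) (sym cover) (⊤⊆VA⊤ v∈⊤)))
    ... | inj₁ v∈A  = x∈p∪q⁺ (inj₁ v∈A)
    ... | inj₂ v∈BC = x∈p∪q⁺ (inj₂ (VA-∪ B C v∈BC))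

  smallSide-choice : ∀ {k} A → lam G A < k → smallSide G k A ⊎ smallSide G k (∁ A)
  smallSide-choice A λA<k with ∣ VA G A ∣ ≤? ∣ VA G (∁ A) ∣
  ... | yes A≤∁A = inj₁ (A≤∁A , λA<k)
  ... | no  A≰∁A = inj₂ ( subst (λ X → ∣ VA G (∁ A) ∣ ≤ ∣ VA G X ∣) (sym (∁-involutive A)) (<⇒≤ (≰⇒> A≰∁A))
                        , subst (_< _) (sym (lam-∁ A)) λA<k)

  smallSide⇒∣VA∣<s : ∀ {s k} → Unbreakable G s k → ∀ A → smallSide G k A → ∣ VA G A ∣ < s
  smallSide⇒∣VA∣<s {s} unbreakable A (A≤∁A , λA<k) with s ≤? ∣ VA G A ∣
  ... | yes s≤A = ⊥-elim (unbreakable (A , λA<k , s≤A , ≤-trans s≤A A≤∁A))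
  ... | no  s≰A = ≰⇒> s≰A

lemma3p5 : (G : Hypergraph) → Normal G → (s k : ℕ) → 1 ≤ k → k ≤ s →
    Unbreakable G s k → 3 * s ≤ n G →
    IsTangle G k (smallSide G k)
lemma3p5 G normal s k _ _ unbreakable 3s≤n = record
  { order    = λ _ (_ , λA<k) → λA<k
  ; choice   = smallSide-choice G
  ; noCover  = noCover
  ; noCoEdge = noCoEdge
  }
  where
  small : ∀ A → smallSide G k A → ∣ VA G A ∣ < s
  small = smallSide⇒∣VA∣<s G {s} {k} unbreakable

  noCover : ∀ A B C → smallSide G k A → smallSide G k B → smallSide G k C → ¬ (A ∪ B ∪ C ≡ ⊤)
  noCover A B C tA tB tC cover = <⇒≱ sum<3s (≤-trans 3s≤n (covering-bound G A B C cover))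
    where
    sum<3s : ∣ VA G A ∣ + (∣ VA G B ∣ + ∣ VA G C ∣) < 3 * s
    sum<3s = subst (λ z → _ < s + (s + z)) (sym (+-identityʳ s))
               (+-mono-< (small A tA) (+-mono-< (small B tB) (small C tC)))

  noCoEdge : ∀ e → ¬ smallSide G k (∁ ⁅ e ⁆)
  noCoEdge e t = <⇒≱ (small (∁ ⁅ e ⁆) t)
    (≤-trans (m≤m+n s _) (≤-trans 3s≤n (⊤⊆p⇒n≤∣p∣ (⊤⊆VA∁⁅e⁆ G normal e))))
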